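{- Let $D=\{e_1,\dots,e_d\}$ be a set with $d$ elements listed in this order, and let $s$ be an integer with $1\le s\le d$. Then the $s$-element subsets of $D$ can be ordered as $S_1,\dots,S_{\binom{d}{s}}$ so that for all $1\le i\le\binom{d}{s}$ and $1\le j\le d$ with $i\equiv j\pmod d$, we have $e_j\in S_i$. -}

module Defs where

open import Data.Nat using (ℕ; _+_; _*_)
open import Data.Fin using (Fin; toℕ)
open import Data.Product using (∃)
open import Relation.Binary.PropositionalEquality using (_≡_)

-- Congruence of (0-based) indices modulo d:  i ≡ j (mod d) where j < d,
-- expressed as  i = j + k·d  for some k (valid since 0 ≤ j < d).
_≡[mod_]_ : ℕ → ℕ → ℕ → Set
i ≡[mod d ] j = ∃ λ k → i ≡ j + k * d

-- Rotating a subset of Z/d by one step maps "contains j" to "contains j + 1", and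
-- rotation permutes the s-subsets, so they split into rotation orbits.  List them
-- orbit by orbit: inside an orbit each subset is the rotation of the previous one,
-- so the residue it must contain advances together with its position.  When an orbit
-- is exhausted, the unlisted subsets are again closed under rotation (rotation is
-- injective), so rotating any of them, which is nonempty as s ≥ 1, yields an
-- unlisted subset containing the residue required at the current position.
module Submission where

open import Defs
open import Data.Nat using (ℕ; zero; suc; _+_; _*_; _∸_; _≤_)
open import Data.Nat.Properties
  using (suc-injective; +-identityʳ; +-suc; +-assoc; +-comm; m≤m+n; m≤n+m; ≤-trans; ≤-reflexive; <⇒≱; m∸n+n≡m; <⇒≤)
open import Data.Nat.GeneralisedArithmetic using (fold)
open import Data.Nat.Combinatorics using (_C_; nCk+nC[k+1]≡[n+1]C[k+1])
open import Data.Fin using (Fin; toℕ; fromℕ; inject₁; cast) renaming (zero to fzero; suc to fsuc)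
open import Data.Fin.Properties using (toℕ-injective; toℕ<n; toℕ-fromℕ; toℕ-inject₁; toℕ-cast)
open import Data.Fin.Subset using (Subset; _∈_; ∣_∣; inside; outside; ⊥; Nonempty)
open import Data.Fin.Subset.Properties using (∣⊥∣≡0)
open import Data.Vec using (Vec; _∷_; []; here; there; head; tail; init; last; initLast; _∷ʳ_)
open import Data.Vec.Properties using (≡-dec; ∷-injectiveʳ)
open import Data.Bool.Properties using () renaming (_≟_ to _≟ᵇ_)
open import Data.List using (List; []; _∷_; [_]; _++_; map; length; lookup)
open import Data.List.Properties using (length-++; length-map)
open import Data.List.Membership.Propositional using () renaming (_∈_ to _∈ₗ_; _∉_ to _∉ₗ_)
open import Data.List.Membership.Propositional.Properties using (∈-∃++; ∈-map⁺; ∈-map⁻; ∈-++⁺ˡ; ∈-++⁺ʳ; ∈-++⁻; ∈-lookup)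
open import Data.List.Relation.Unary.Any using (here; there; index)
open import Data.List.Relation.Unary.Any.Properties using (lookup-index)
open import Data.List.Relation.Unary.All using (All)
import Data.List.Relation.Unary.All as All
open import Data.List.Relation.Unary.AllPairs using ([]; _∷_)
open import Data.List.Relation.Unary.Unique.Propositional using (Unique)
import Data.List.Relation.Unary.Unique.Propositional.Properties as Unique
open import Data.List.Relation.Binary.Permutation.Propositional using (_↭_; ↭-refl; ↭-sym; ↭-trans; ↭-prep; ↭⇒↭ₛ)
open import Data.List.Relation.Binary.Permutation.Propositional.Properties using (∈-resp-↭; ↭-length; shift; All-resp-↭)
import Data.List.Relation.Binary.Permutation.Setoid.Properties as Permutationₛ
open import Data.Product using (Σ; ∃; ∃₂; _×_; _,_; proj₁; proj₂)
import Data.Product as Product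
open import Data.Sum using (_⊎_; inj₁; inj₂; swap)
open import Data.Unit using (⊤; tt)
open import Data.Empty using (⊥-elim)
open import Function.Definitions using (Injective)
open import Relation.Nullary using (¬_; yes; no)
open import Relation.Binary.Definitions using (DecidableEquality)
open import Relation.Binary.PropositionalEquality using (_≡_; refl; sym; trans; cong; cong₂; subst; setoid; module ≡-Reasoning)

private
  variable
    A : Set
    n k p : ℕ

Unique-resp-↭ : ∀ {xs ys : List A} → xs ↭ ys → Unique xs → Unique ys
Unique-resp-↭ {A = A} xs↭ = Permutationₛ.Unique-resp-↭ (setoid A) (↭⇒↭ₛ xs↭)

module _ {x : A} {xs ys : List A} (xs↭ : xs ↭ x ∷ ys) where

  ↭∷-∈⁻ : ∀ {z} → z ∈ₗ xs → z ≡ x ⊎ z ∈ₗ ys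
  ↭∷-∈⁻ z∈ with ∈-resp-↭ xs↭ z∈
  ... | here z≡x = inj₁ z≡x
  ... | there z∈ys = inj₂ z∈ys

  ↭∷-∈⁺ : ∀ {z} → z ∈ₗ x ∷ ys → z ∈ₗ xs
  ↭∷-∈⁺ = ∈-resp-↭ (↭-sym xs↭)

  ↭∷-Unique : Unique xs → x ∉ₗ ys × Unique ys
  ↭∷-Unique unique with Unique-resp-↭ xs↭ unique
  ... | unique′@(_ ∷ uniqueys) = Unique.Unique[x∷xs]⇒x∉xs unique′ , uniqueys

∈⇒↭∷ : ∀ {x : A} {xs} → x ∈ₗ xs → ∃ λ ys → xs ↭ x ∷ ys
∈⇒↭∷ x∈ with ∈-∃++ x∈
... | ys , zs , refl = ys ++ zs , shift _ ys zs

Unique⇒lookup-injective : ∀ {xs : List A} → Unique xs → ∀ {i j} → lookup xs i ≡ lookup xs j → i ≡ j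
Unique⇒lookup-injective (x∉ ∷ u) {fzero} {fzero} _ = refl
Unique⇒lookup-injective (x∉ ∷ u) {fzero} {fsuc j} eq = ⊥-elim (All.lookup x∉ (∈-lookup j) eq)
Unique⇒lookup-injective (x∉ ∷ u) {fsuc i} {fzero} eq = ⊥-elim (All.lookup x∉ (∈-lookup i) (sym eq))
Unique⇒lookup-injective (x∉ ∷ u) {fsuc i} {fsuc j} eq = cong fsuc (Unique⇒lookup-injective u eq)

module _ (xs : List A) (len : length xs ≡ n) where

  lookupCast : Fin n → A
  lookupCast i = lookup xs (cast (sym len) i)

  lookupCast-∈ : ∀ i → lookupCast i ∈ₗ xs
  lookupCast-∈ i = ∈-lookup (cast (sym len) i)

  lookupCast-surjective : ∀ {x} → x ∈ₗ xs → ∃ λ i → lookupCast i ≡ x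
  lookupCast-surjective x∈ = cast len (index x∈) , trans (cong (lookup xs) cast-cast) (sym (lookup-index x∈))
    where
    cast-cast : cast (sym len) (cast len (index x∈)) ≡ index x∈
    cast-cast = toℕ-injective (trans (toℕ-cast (sym len) (cast len (index x∈))) (toℕ-cast len (index x∈)))

  lookupCast-injective : Unique xs → Injective _≡_ _≡_ lookupCast
  lookupCast-injective unique {i} {j} eq = toℕ-injective (begin
    toℕ i                   ≡⟨ toℕ-cast (sym len) i ⟨
    toℕ (cast (sym len) i)  ≡⟨ cong toℕ (Unique⇒lookup-injective unique eq) ⟩
    toℕ (cast (sym len) j)  ≡⟨ toℕ-cast (sym len) j ⟩
    toℕ j                   ∎)
    where open ≡-Reasoning

module CyclicOrdering
  {X : Set} (_≟_ : DecidableEquality X)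
  (σ : X → X) (σ-injective : ∀ {x y} → σ x ≡ σ y → x ≡ y)
  (Good : ℕ → X → Set) (Good-σ : ∀ {p x} → Good p x → Good (suc p) (σ x))
  where

  open import Data.List.Membership.DecPropositional _≟_ using (_∈?_)

  Reaches : X → Set
  Reaches x = ∀ p → ∃ λ k → Good p (fold x σ k)

  GoodFrom : ℕ → List X → Set
  GoodFrom p [] = ⊤
  GoodFrom p (x ∷ xs) = Good p x × GoodFrom (suc p) xs

  lookup-GoodFrom : ∀ {p} xs → GoodFrom p xs → ∀ i → Good (toℕ i + p) (lookup xs i)
  lookup-GoodFrom (x ∷ xs) (good , _) fzero = good
  lookup-GoodFrom {p} (x ∷ xs) (_ , goods) (fsuc i) =
    subst (λ q → Good q (lookup xs i)) (+-suc (toℕ i) p) (lookup-GoodFrom xs goods i)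

  Closed : List X → Set
  Closed R = ∀ {x} → x ∈ₗ R → σ x ∈ₗ R

  fold-Closed : ∀ {R x} → Closed R → x ∈ₗ R → ∀ k → fold x σ k ∈ₗ R
  fold-Closed closed x∈ zero = x∈
  fold-Closed closed x∈ (suc k) = closed (fold-Closed closed x∈ k)

  StepsInto : List X → X → X → Set
  StepsInto R start x = σ x ∈ₗ R ⊎ σ x ≡ start

  -- The orbit of start is being listed and current is the last element emitted:
  -- the unlisted R is closed under σ except for the arrow closing that orbit.
  record Chain (R : List X) (p : ℕ) : Set where
    field
      start current : X
      current∉ : current ∉ₗ R
      steps-into : ∀ {x} → x ∈ₗ R → StepsInto R start x
      current-steps-into : StepsInto R start current
      Good-next : Good p (σ current)

  State : List X → ℕ → Set
  State R p = Closed R ⊎ Chain R p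

  startChain : ∀ {R R' y p} → Unique R → Closed R → R ↭ y ∷ R' → Good p y → Chain R' (suc p)
  startChain {y = y} unique closed R↭ good = record
    { start = y
    ; current = y
    ; current∉ = proj₁ (↭∷-Unique R↭ unique)
    ; steps-into = λ x∈ → lands (↭∷-∈⁺ R↭ (there x∈))
    ; current-steps-into = lands (↭∷-∈⁺ R↭ (here refl))
    ; Good-next = Good-σ good
    }
    where
    lands : ∀ {x} → x ∈ₗ _ → StepsInto _ y x
    lands x∈ = swap (↭∷-∈⁻ R↭ (closed x∈))

  extendChain : ∀ {R R' p} → Unique R → (c : Chain R p) →
                R ↭ σ (Chain.current c) ∷ R' → Chain R' (suc p)
  extendChain {R} unique c R↭ = record
    { start = start
    ; current = σ current
    ; current∉ = proj₁ (↭∷-Unique R↭ unique)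
    ; steps-into = λ x∈ → shrink (↭∷-∈⁺ R↭ (there x∈))
    ; current-steps-into = shrink (↭∷-∈⁺ R↭ (here refl))
    ; Good-next = Good-σ Good-next
    }
    where
    open Chain c
    shrink : ∀ {x} → x ∈ₗ R → StepsInto _ start x
    shrink x∈ with steps-into x∈
    ... | inj₂ σx≡start = inj₂ σx≡start
    ... | inj₁ σx∈ with ↭∷-∈⁻ R↭ σx∈
    ...   | inj₁ σx≡σc = ⊥-elim (current∉ (subst (_∈ₗ R) (σ-injective σx≡σc) x∈))
    ...   | inj₂ σx∈R' = inj₁ σx∈R'

  -- If the orbit cannot be continued, it has returned to start; by injectivity of σ
  -- no other element of R maps to start.
  chainClosed : ∀ {R p} (c : Chain R p) → σ (Chain.current c) ∉ₗ R → Closed R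
  chainClosed {R} c σc∉ {x} x∈ = returns (steps-into x∈) current-steps-into
    where
    open Chain c
    returns : StepsInto R start x → StepsInto R start current → σ x ∈ₗ R
    returns (inj₁ σx∈) _ = σx∈
    returns (inj₂ _) (inj₁ σc∈) = ⊥-elim (σc∉ σc∈)
    returns (inj₂ σx≡start) (inj₂ σc≡start) =
      ⊥-elim (current∉ (subst (_∈ₗ R) (σ-injective (trans σx≡start (sym σc≡start))) x∈))

  Closed⇒∃Good : ∀ {R x} → Closed R → All Reaches R → x ∈ₗ R → ∀ p → ∃ λ y → y ∈ₗ R × Good p y
  Closed⇒∃Good closed reaches x∈ p with All.lookup reaches x∈ p
  ... | k , good = _ , fold-Closed closed x∈ k , good

  Emission : List X → ℕ → Set
  Emission R p = ∃₂ λ y R' → R ↭ y ∷ R' × Good p y × State R' (suc p)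

  emit : ∀ {R x p} → Unique R → All Reaches R → x ∈ₗ R → State R p → Emission R p
  emit {R} {p = p} unique reaches x∈ = λ
    { (inj₁ closed) → fromClosed closed
    ; (inj₂ c) → fromChain c
    }
    where
    fromClosed : Closed R → Emission R p
    fromClosed closed =
      let y , y∈ , good = Closed⇒∃Good closed reaches x∈ p
          R' , R↭ = ∈⇒↭∷ y∈
      in y , R' , R↭ , good , inj₂ (startChain unique closed R↭ good)
    fromChain : Chain R p → Emission R p
    fromChain c with σ (Chain.current c) ∈? R
    ... | no σc∉ = fromClosed (chainClosed c σc∉)
    ... | yes σc∈ =
      let R' , R↭ = ∈⇒↭∷ σc∈
      in _ , R' , R↭ , Chain.Good-next c , inj₂ (extendChain unique c R↭)

  order : ∀ n {R p} → length R ≡ n → Unique R → All Reaches R → State R p →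
          ∃ λ L → L ↭ R × GoodFrom p L
  order zero {[]} _ _ _ _ = [] , ↭-refl , tt
  order (suc n) {x ∷ R} len unique reaches state =
    let y , R' , R↭ , good , state′ = emit unique reaches (here refl) state
        L , L↭R' , goods = order n (suc-injective (trans (sym (↭-length R↭)) len))
                                   (proj₂ (↭∷-Unique R↭ unique))
                                   (All.tail (All-resp-↭ R↭ reaches))
                                   state′
    in y ∷ L , ↭-trans (↭-prep y L↭R') (↭-sym R↭) , good , goods

  cyclicOrdering : ∀ {R} → Unique R → Closed R → All Reaches R → ∃ λ L → L ↭ R × GoodFrom 0 L
  cyclicOrdering unique closed reaches = order _ refl unique reaches (inj₁ closed)

  cyclicEnumeration : ∀ {R m} → length R ≡ m → Unique R → Closed R → All Reaches R →
    Σ (Fin m → X) λ f → (∀ i → f i ∈ₗ R) × Injective _≡_ _≡_ f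
                      × (∀ {x} → x ∈ₗ R → ∃ λ i → f i ≡ x) × (∀ i → Good (toℕ i) (f i))
  cyclicEnumeration {R} len unique closed reaches with cyclicOrdering unique closed reaches
  ... | L , L↭R , goods = lookupCast L lenL , ∈R , injective , onto , good
    where
    lenL : length L ≡ _
    lenL = trans (↭-length L↭R) len
    ∈R : ∀ i → lookupCast L lenL i ∈ₗ R
    ∈R i = ∈-resp-↭ L↭R (lookupCast-∈ L lenL i)
    injective : Injective _≡_ _≡_ (lookupCast L lenL)
    injective = lookupCast-injective L lenL (Unique-resp-↭ (↭-sym L↭R) unique)
    onto : ∀ {x} → x ∈ₗ R → ∃ λ i → lookupCast L lenL i ≡ x
    onto x∈ = lookupCast-surjective L lenL (∈-resp-↭ (↭-sym L↭R) x∈)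
    good : ∀ i → Good (toℕ i) (lookupCast L lenL i)
    good i = subst (λ q → Good q (lookupCast L lenL i))
                   (trans (+-identityʳ _) (toℕ-cast (sym lenL) i))
                   (lookup-GoodFrom L goods (cast (sym lenL) i))

rotate : Vec A (suc n) → Vec A (suc n)
rotate xs = last xs ∷ init xs

init-∷ʳ-last : (xs : Vec A (suc n)) → init xs ∷ʳ last xs ≡ xs
init-∷ʳ-last xs = sym (proj₂ (proj₂ (initLast xs)))

rotate-injective : {xs ys : Vec A (suc n)} → rotate xs ≡ rotate ys → xs ≡ ys
rotate-injective {xs = xs} {ys} eq = begin
  xs                  ≡⟨ init-∷ʳ-last xs ⟨
  init xs ∷ʳ last xs  ≡⟨ cong₂ _∷ʳ_ (cong tail eq) (cong head eq) ⟩
  init ys ∷ʳ last ys  ≡⟨ init-∷ʳ-last ys ⟩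
  ys                  ∎
  where open ≡-Reasoning

∣x∷p∣≡∣p∷ʳx∣ : ∀ x (p : Subset n) → ∣ x ∷ p ∣ ≡ ∣ p ∷ʳ x ∣
∣x∷p∣≡∣p∷ʳx∣ x [] = refl
∣x∷p∣≡∣p∷ʳx∣ outside (outside ∷ p) = ∣x∷p∣≡∣p∷ʳx∣ outside p
∣x∷p∣≡∣p∷ʳx∣ outside (inside ∷ p) = cong suc (∣x∷p∣≡∣p∷ʳx∣ outside p)
∣x∷p∣≡∣p∷ʳx∣ inside (outside ∷ p) = ∣x∷p∣≡∣p∷ʳx∣ inside p
∣x∷p∣≡∣p∷ʳx∣ inside (inside ∷ p) = cong suc (∣x∷p∣≡∣p∷ʳx∣ inside p)

∣rotate∣ : (p : Subset (suc n)) → ∣ rotate p ∣ ≡ ∣ p ∣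
∣rotate∣ p = trans (∣x∷p∣≡∣p∷ʳx∣ (last p) (init p)) (cong ∣_∣ (init-∷ʳ-last p))

inject₁∈⇒∈init : ∀ {i : Fin n} {p : Subset (suc n)} → inject₁ i ∈ p → i ∈ init p
inject₁∈⇒∈init {i = fzero} {inside ∷ _ ∷ _} here = here
inject₁∈⇒∈init {i = fsuc i} {_ ∷ _ ∷ _} (there i∈) = there (inject₁∈⇒∈init i∈)

fromℕ∈⇒last≡inside : ∀ {p : Subset (suc n)} → fromℕ n ∈ p → last p ≡ inside
fromℕ∈⇒last≡inside {p = _ ∷ []} here = refl
fromℕ∈⇒last≡inside {p = _ ∷ _ ∷ _} (there n∈) = fromℕ∈⇒last≡inside n∈

infix 4 _∈ᵐ_
_∈ᵐ_ : ℕ → Subset n → Set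
_∈ᵐ_ {n} p S = ∀ j → p ≡[mod n ] toℕ j → j ∈ S

∈ᵐ-rotate : {S : Subset (suc n)} → p ∈ᵐ S → suc p ∈ᵐ rotate S
∈ᵐ-rotate {n} {p} {S} p∈ fzero (suc k , sp≡) =
  subst (λ x → fzero ∈ x ∷ init S) (sym (fromℕ∈⇒last≡inside (p∈ (fromℕ n) (k , p≡)))) here
  where
  p≡ : p ≡ toℕ (fromℕ n) + k * suc n
  p≡ = trans (suc-injective sp≡) (cong (_+ k * suc n) (sym (toℕ-fromℕ n)))
∈ᵐ-rotate {n} p∈ (fsuc j) (k , sp≡) =
  there (inject₁∈⇒∈init (p∈ (inject₁ j) (k , p≡)))
  where
  p≡ : _ ≡ toℕ (inject₁ j) + k * suc n
  p≡ = trans (suc-injective sp≡) (cong (_+ k * suc n) (sym (toℕ-inject₁ j)))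

∈ᵐ-periodic : {S : Subset n} → p + n ∈ᵐ S → p ∈ᵐ S
∈ᵐ-periodic {n} {p} p+n∈ j (k , p≡) = p+n∈ j (suc k , p+n≡)
  where
  open ≡-Reasoning
  p+n≡ : p + n ≡ toℕ j + suc k * n
  p+n≡ = begin
    p + n                ≡⟨ cong (_+ n) p≡ ⟩
    toℕ j + k * n + n    ≡⟨ +-assoc (toℕ j) (k * n) n ⟩
    toℕ j + (k * n + n)  ≡⟨ cong (toℕ j +_) (+-comm (k * n) n) ⟩
    toℕ j + suc k * n    ∎

toℕ≡+*⇒≡ : ∀ (i j : Fin n) k → toℕ i ≡ toℕ j + k * n → i ≡ j
toℕ≡+*⇒≡ i j zero i≡ = toℕ-injective (trans i≡ (+-identityʳ (toℕ j)))
toℕ≡+*⇒≡ {n} i j (suc k) i≡ = ⊥-elim (<⇒≱ (toℕ<n i) n≤i)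
  where
  n≤i : n ≤ toℕ i
  n≤i = ≤-trans (m≤m+n n (k * n)) (≤-trans (m≤n+m _ (toℕ j)) (≤-reflexive (sym i≡)))

∈⇒toℕ∈ᵐ : ∀ {i} {S : Subset n} → i ∈ S → toℕ i ∈ᵐ S
∈⇒toℕ∈ᵐ {i = i} {S} i∈ j (k , i≡) = subst (_∈ S) (toℕ≡+*⇒≡ i j k i≡) i∈

fold-∈ᵐ : ∀ {q} {S : Subset (suc n)} k → q ∈ᵐ S → k + q ∈ᵐ fold S rotate k
fold-∈ᵐ zero q∈ = q∈
fold-∈ᵐ (suc k) q∈ = ∈ᵐ-rotate (fold-∈ᵐ k q∈)

Nonempty⇒rotations∈ᵐ : {S : Subset (suc n)} → Nonempty S → ∀ p → ∃ λ k → p ∈ᵐ fold S rotate k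
Nonempty⇒rotations∈ᵐ {n} {S} (i , i∈) p =
  turns , ∈ᵐ-periodic (subst (_∈ᵐ fold S rotate turns) turns+i≡ (fold-∈ᵐ turns (∈⇒toℕ∈ᵐ i∈)))
  where
  turns : ℕ
  turns = p + (suc n ∸ toℕ i)
  turns+i≡ : turns + toℕ i ≡ p + suc n
  turns+i≡ = trans (+-assoc p _ (toℕ i)) (cong (p +_) (m∸n+n≡m (<⇒≤ (toℕ<n i))))

∣∣≡suc⇒Nonempty : ∀ (S : Subset n) → ∣ S ∣ ≡ suc k → Nonempty S
∣∣≡suc⇒Nonempty (inside ∷ S) _ = fzero , here
∣∣≡suc⇒Nonempty (outside ∷ S) ∣S∣≡ = Product.map fsuc there (∣∣≡suc⇒Nonempty S ∣S∣≡)

∣∣≡0⇒≡⊥ : ∀ (S : Subset n) → ∣ S ∣ ≡ 0 → S ≡ ⊥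
∣∣≡0⇒≡⊥ [] _ = refl
∣∣≡0⇒≡⊥ (outside ∷ S) ∣S∣≡0 = cong (outside ∷_) (∣∣≡0⇒≡⊥ S ∣S∣≡0)

subsetsOfSize : (n k : ℕ) → List (Subset n)
subsetsOfSize n zero = [ ⊥ ]
subsetsOfSize zero (suc k) = []
subsetsOfSize (suc n) (suc k) =
  map (outside ∷_) (subsetsOfSize n (suc k)) ++ map (inside ∷_) (subsetsOfSize n k)

length-subsetsOfSize : (n k : ℕ) → length (subsetsOfSize n k) ≡ n C k
length-subsetsOfSize n zero = refl
length-subsetsOfSize zero (suc k) = refl
length-subsetsOfSize (suc n) (suc k) = begin
  length (map (outside ∷_) (subsetsOfSize n (suc k)) ++ map (inside ∷_) (subsetsOfSize n k))
    ≡⟨ length-++ (map (outside ∷_) (subsetsOfSize n (suc k))) ⟩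
  length (map (outside ∷_) (subsetsOfSize n (suc k))) + length (map (inside ∷_) (subsetsOfSize n k))
    ≡⟨ cong₂ _+_ (length-map _ (subsetsOfSize n (suc k))) (length-map _ (subsetsOfSize n k)) ⟩
  length (subsetsOfSize n (suc k)) + length (subsetsOfSize n k)
    ≡⟨ cong₂ _+_ (length-subsetsOfSize n (suc k)) (length-subsetsOfSize n k) ⟩
  n C suc k + n C k
    ≡⟨ +-comm (n C suc k) (n C k) ⟩
  n C k + n C suc k
    ≡⟨ nCk+nC[k+1]≡[n+1]C[k+1] n k ⟩
  suc n C suc k ∎
  where open ≡-Reasoning

∈-subsetsOfSize⇒∣∣≡ : (n k : ℕ) {S : Subset n} → S ∈ₗ subsetsOfSize n k → ∣ S ∣ ≡ k
∈-subsetsOfSize⇒∣∣≡ n zero (here refl) = ∣⊥∣≡0 n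
∈-subsetsOfSize⇒∣∣≡ (suc n) (suc k) S∈ with ∈-++⁻ (map (outside ∷_) (subsetsOfSize n (suc k))) S∈
... | inj₁ S∈ˡ with ∈-map⁻ (outside ∷_) S∈ˡ
...   | _ , S′∈ , refl = ∈-subsetsOfSize⇒∣∣≡ n (suc k) S′∈
∈-subsetsOfSize⇒∣∣≡ (suc n) (suc k) S∈ | inj₂ S∈ʳ with ∈-map⁻ (inside ∷_) S∈ʳ
...   | _ , S′∈ , refl = cong suc (∈-subsetsOfSize⇒∣∣≡ n k S′∈)

∣∣≡⇒∈-subsetsOfSize : (n k : ℕ) (S : Subset n) → ∣ S ∣ ≡ k → S ∈ₗ subsetsOfSize n k
∣∣≡⇒∈-subsetsOfSize n zero S ∣S∣≡0 = here (∣∣≡0⇒≡⊥ S ∣S∣≡0)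
∣∣≡⇒∈-subsetsOfSize (suc n) (suc k) (outside ∷ S) ∣S∣≡ =
  ∈-++⁺ˡ (∈-map⁺ (outside ∷_) (∣∣≡⇒∈-subsetsOfSize n (suc k) S ∣S∣≡))
∣∣≡⇒∈-subsetsOfSize (suc n) (suc k) (inside ∷ S) ∣S∣≡ =
  ∈-++⁺ʳ (map (outside ∷_) (subsetsOfSize n (suc k)))
    (∈-map⁺ (inside ∷_) (∣∣≡⇒∈-subsetsOfSize n k S (suc-injective ∣S∣≡)))

subsetsOfSize-Unique : (n k : ℕ) → Unique (subsetsOfSize n k)
subsetsOfSize-Unique n zero = All.[] ∷ []
subsetsOfSize-Unique zero (suc k) = []
subsetsOfSize-Unique (suc n) (suc k) =
  Unique.++⁺ (Unique.map⁺ ∷-injectiveʳ (subsetsOfSize-Unique n (suc k)))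
             (Unique.map⁺ ∷-injectiveʳ (subsetsOfSize-Unique n k))
             disjoint
  where
  disjoint : ∀ {S} → ¬ (S ∈ₗ map (outside ∷_) (subsetsOfSize n (suc k))
                       × S ∈ₗ map (inside ∷_) (subsetsOfSize n k))
  disjoint (S∈ˡ , S∈ʳ) with ∈-map⁻ (outside ∷_) S∈ˡ | ∈-map⁻ (inside ∷_) S∈ʳ
  ... | _ , _ , refl | _ , _ , ()

rotate-subsetsOfSize : ∀ {n k} {S : Subset (suc n)} →
                       S ∈ₗ subsetsOfSize (suc n) k → rotate S ∈ₗ subsetsOfSize (suc n) k
rotate-subsetsOfSize {n} {k} {S} S∈ =
  ∣∣≡⇒∈-subsetsOfSize (suc n) k (rotate S) (trans (∣rotate∣ S) (∈-subsetsOfSize⇒∣∣≡ (suc n) k S∈))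

module SubsetRotation (n : ℕ) =
  CyclicOrdering (≡-dec _≟ᵇ_) (rotate {n = n}) rotate-injective _∈ᵐ_ ∈ᵐ-rotate

lemma7p1 : (d s : ℕ) → 1 ≤ s → s ≤ d →
    Σ (Fin (d C s) → Subset d) λ S →
      ((i : Fin (d C s)) → ∣ S i ∣ ≡ s)
      × Injective _≡_ _≡_ S
      × ((P : Subset d) → ∣ P ∣ ≡ s → ∃ λ i → S i ≡ P)
      × ((i : Fin (d C s)) (j : Fin d) → toℕ i ≡[mod d ] toℕ j → j ∈ S i)
lemma7p1 zero zero () _
lemma7p1 zero (suc s) _ ()
lemma7p1 (suc d) zero () _
lemma7p1 (suc n) (suc k) _ _ =
  let S , S∈ , injective , onto , contains =
        SubsetRotation.cyclicEnumeration n
          (length-subsetsOfSize (suc n) (suc k))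
          (subsetsOfSize-Unique (suc n) (suc k))
          rotate-subsetsOfSize
          (All.tabulate λ S∈ →
            Nonempty⇒rotations∈ᵐ (∣∣≡suc⇒Nonempty _ (∈-subsetsOfSize⇒∣∣≡ (suc n) (suc k) S∈)))
  in S
   , (λ i → ∈-subsetsOfSize⇒∣∣≡ (suc n) (suc k) (S∈ i))
   , injective
   , (λ P ∣P∣≡ → onto (∣∣≡⇒∈-subsetsOfSize (suc n) (suc k) P ∣P∣≡))
   , contains
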